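{- Let $A$ and $B$ be nonzero integers that are not coprime, and let $L$ be a positive integer. Let $g=\gcd(A,B)$, write $A=ga$, $B=gb$ (so $\gcd(a,b)=1$), let $\ell=\prod_{p\nmid g} p^{\nu_p(L)}$ and $\gamma(L)=\max_{p\mid g}\lceil \nu_p(L)/\nu_p(g)\rceil$. Then the following are equivalent: (i) there exists a positive integer $K$ such that $L\mid (A^K+B^K)$; (ii) there exists a positive integer $\kappa\ge \gamma(L)$ such that $\ell \mid (a^\kappa+b^\kappa)$; (iii) there exists a positive integer $k$ such that $\ell\mid (a^k+b^k)$.
   Context: For a prime $p$ and nonzero integer $n$, $\nu_p(n)$ is the $p$-adic valuation (exponent of $p$ in $n$). In the definition of $\ell$ the product runs over primes not dividing $g$, and in $\gamma(L)$ the maximum runs over primes dividing $g$; $\lceil x\rceil$ is the ceiling. Note $L=\bigl(\prod_{p\mid g}p^{\nu_p(L)}\bigr)\ell$ with $\gcd(\ell,g)=1$. -}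

module Defs where

open import Data.Nat using (ℕ; zero; suc; _+_; _^_; _⊔_; _/_; _≤_)
open import Data.Nat.Divisibility using (_∣_; _∣?_; divides)
open import Data.Nat.Primality using (prime?)
open import Data.List using (List; filter; map; upTo; foldr)
open import Data.Nat.ListAction using (product)
open import Relation.Nullary using (yes; no; ¬?)
open import Relation.Nullary.Decidable using (_×-dec_)

-- p-adic valuation ν p n (with fuel).  Only meaningful for p prime and
-- n ≠ 0; conventions: ν p 0 = 0 and ν p n = 0 for p ≤ 1.
νAux : ℕ → ℕ → ℕ → ℕ
νAux zero p n = 0
νAux (suc f) zero n = 0
νAux (suc f) (suc zero) n = 0
νAux (suc f) (suc (suc p)) zero = 0
νAux (suc f) (suc (suc p)) (suc n) with suc (suc p) ∣? suc n
... | yes (divides q _) = suc (νAux f (suc (suc p)) q)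
... | no _ = 0

ν : ℕ → ℕ → ℕ
ν p n = νAux n p n

-- ceiling division ⌈ x / y ⌉ (y = 0 gives 0; never used with y = 0)
ceilDiv : ℕ → ℕ → ℕ
ceilDiv x zero = 0
ceilDiv x (suc y) = (x + y) / suc y

-- ℓ(L, g) = ∏_{p prime, p ∤ g} p^{ν_p(L)}  (primes p > L contribute 1)
ℓ : ℕ → ℕ → ℕ
ℓ L g = product (map (λ p → p ^ ν p L)
          (filter (λ p → prime? p ×-dec ¬? (p ∣? g)) (upTo (suc L))))

-- γ(L) = max_{p prime, p ∣ g} ⌈ ν_p(L) / ν_p(g) ⌉   (g ≥ 1; primes dividing g are ≤ g)
γ : ℕ → ℕ → ℕ
γ L g = foldr _⊔_ 0 (map (λ p → ceilDiv (ν p L) (ν p g))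
          (filter (λ p → prime? p ×-dec (p ∣? g)) (upTo (suc g))))

{-# OPTIONS --safe #-}
-- Write |A^K + B^K| = g^K |a^K + b^K|.  Since ℓ is the largest divisor of L coprime to g,
-- L ∣ g^K (a^K + b^K) forces ℓ ∣ a^K + b^K; conversely, once κ ≥ γ(L) every prime power
-- p^ν_p(L) with p ∣ g already divides g^κ, so L ∣ g^κ ℓ.  Finally a^k + b^k divides
-- (a^k)^m + (b^k)^m for every odd m, which trades any k for k (2γ(L) + 1) ≥ γ(L).
module Submission where

module NatArithmetic where

  open import Defs
  open import Data.Nat
  open import Data.Nat.Properties
  open import Data.Nat.Divisibility
  open import Data.Nat.DivMod using (m≡m%n+[m/n]*n; m%n<n)
  open import Data.Nat.GCD using (gcd)
  open import Data.Nat.LCM using (lcm; lcm-least; gcd*lcm)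
  open import Data.Nat.Coprimality using (Coprime; 1-coprimeTo; coprime⇒gcd≡1; coprime-divisor)
  import Data.Nat.Coprimality as Coprime
  open import Data.Nat.Primality using (Prime; prime?; prime⇒irreducible; prime⇒nonTrivial)
  open import Data.Nat.Primality.Factorisation using (factorise)
  open import Data.Nat.ListAction using (product)
  open import Data.Nat.ListAction.Properties using (∈⇒∣product)
  open import Data.Nat.Induction using (<-wellFounded)
  open import Induction.WellFounded using (Acc; acc)
  open import Data.Product using (_×_; _,_; proj₁; ∃-syntax)
  open import Data.List using (List; []; _∷_; map; filter; upTo; foldr)
  open import Data.List.Relation.Unary.All using (All; []; _∷_)
  import Data.List.Relation.Unary.All as All
  import Data.List.Relation.Unary.All.Properties as All
  open import Data.List.Relation.Unary.Any using (here; there)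
  open import Data.List.Relation.Unary.AllPairs using ([]; _∷_)
  open import Data.List.Relation.Unary.Unique.Propositional using (Unique)
  import Data.List.Relation.Unary.Unique.Propositional.Properties as Unique
  open import Data.List.Membership.Propositional using (_∈_)
  open import Data.List.Membership.Propositional.Properties using (∈-map⁺; ∈-filter⁺; ∈-upTo⁺)
  open import Data.Sum using (inj₁; inj₂)
  open import Data.Empty using (⊥-elim)
  open import Relation.Nullary using (¬_; ¬?; yes; no)
  open import Relation.Nullary.Decidable using (_×-dec_)
  open import Relation.Binary.PropositionalEquality

  p^νAux∣n : ∀ f p n → p ^ νAux f p n ∣ n
  p^νAux∣n zero    p             n       = 1∣ n
  p^νAux∣n (suc f) zero          n       = 1∣ n
  p^νAux∣n (suc f) (suc zero)    n       = 1∣ n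
  p^νAux∣n (suc f) (suc (suc p)) zero    = _ ∣0
  p^νAux∣n (suc f) p@(suc (suc _)) (suc n) with p ∣? suc n
  ... | no _ = 1∣ suc n
  ... | yes (divides q n+1≡q*p) =
    subst (p * p ^ νAux f p q ∣_) (sym (trans n+1≡q*p (*-comm q p))) (*-monoʳ-∣ p (p^νAux∣n f p q))

  p^[1+νAux]∤n : ∀ f p n → 1 < p → 0 < n → n ≤ f → ¬ (p ^ suc (νAux f p n) ∣ n)
  p^[1+νAux]∤n zero    p (suc n) _ _ ()
  p^[1+νAux]∤n (suc f) (suc zero) n (s≤s ()) _ _
  p^[1+νAux]∤n (suc f) p@(suc (suc _)) (suc n) _ _ n≤f p^[1+ν]∣n with p ∣? suc n
  ... | no p∤n = p∤n (m*n∣⇒m∣ p 1 p^[1+ν]∣n)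
  ... | yes (divides zero ())
  ... | yes (divides q@(suc _) n+1≡q*p) =
    p^[1+νAux]∤n f p q (s≤s (s≤s z≤n)) (s≤s z≤n) q≤f
      (*-cancelˡ-∣ p (subst (p * p ^ suc (νAux f p q) ∣_) (trans n+1≡q*p (*-comm q p)) p^[1+ν]∣n))
    where
    q≤f : q ≤ f
    q≤f = ≤-trans (<⇒≤pred (subst (q <_) (sym n+1≡q*p) (m<m*n q p (s≤s (s≤s z≤n))))) (s≤s⁻¹ n≤f)

  p^ν∣n : ∀ p n → p ^ ν p n ∣ n
  p^ν∣n p n = p^νAux∣n n p n

  p^[1+ν]∤n : ∀ {p n} → 1 < p → 0 < n → ¬ (p ^ suc (ν p n) ∣ n)
  p^[1+ν]∤n {p} {n} 1<p 0<n = p^[1+νAux]∤n n p n 1<p 0<n ≤-refl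

  ^-monoʳ-∣ : ∀ p {m n} → m ≤ n → p ^ m ∣ p ^ n
  ^-monoʳ-∣ p {m} {n} m≤n = divides (p ^ (n ∸ m)) (begin
    p ^ n               ≡⟨ cong (p ^_) (m+[n∸m]≡n m≤n) ⟨
    p ^ (m + (n ∸ m))   ≡⟨ ^-distribˡ-+-* p m (n ∸ m) ⟩
    p ^ m * p ^ (n ∸ m) ≡⟨ *-comm (p ^ m) _ ⟩
    p ^ (n ∸ m) * p ^ m ∎)
    where open ≡-Reasoning

  ^-monoˡ-∣ : ∀ {m n} k → m ∣ n → m ^ k ∣ n ^ k
  ^-monoˡ-∣ zero    m∣n = ∣-refl
  ^-monoˡ-∣ (suc k) m∣n = *-pres-∣ m∣n (^-monoˡ-∣ k m∣n)

  p^e∣n⇒e≤ν : ∀ {p n e} → 1 < p → 0 < n → p ^ e ∣ n → e ≤ ν p n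
  p^e∣n⇒e≤ν {p} {n} {e} 1<p 0<n p^e∣n with e ≤? ν p n
  ... | yes e≤ν = e≤ν
  ... | no e≰ν = ⊥-elim (p^[1+ν]∤n 1<p 0<n (∣-trans (^-monoʳ-∣ p (≰⇒> e≰ν)) p^e∣n))

  ν-mono-∣ : ∀ {p m n} → 1 < p → 0 < n → m ∣ n → ν p m ≤ ν p n
  ν-mono-∣ {p} {m} 1<p 0<n m∣n = p^e∣n⇒e≤ν 1<p 0<n (∣-trans (p^ν∣n p m) m∣n)

  p∣n⇒0<ν : ∀ {p n} → 1 < p → 0 < n → p ∣ n → 0 < ν p n
  p∣n⇒0<ν {p} 1<p 0<n p∣n = p^e∣n⇒e≤ν 1<p 0<n (subst (_∣ _) (sym (*-identityʳ p)) p∣n)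

  0<ν⇒p∣n : ∀ {p n} → 0 < ν p n → p ∣ n
  0<ν⇒p∣n {p} {n} 0<ν with ν p n | p^ν∣n p n
  ... | suc k | p^[1+k]∣n = ∣-trans (m∣m*n (p ^ k)) p^[1+k]∣n

  p∤n/p^ν : ∀ {p n} → 1 < p → 0 < n → ¬ (p ∣ quotient (p^ν∣n p n))
  p∤n/p^ν {p} {n} 1<p 0<n p∣M = p^[1+ν]∤n 1<p 0<n (begin
    p ^ suc (ν p n)               ≡⟨ *-comm p (p ^ ν p n) ⟩
    p ^ ν p n * p                 ∣⟨ *-monoʳ-∣ (p ^ ν p n) p∣M ⟩
    p ^ ν p n * quotient p^ν[n]∣n ≡⟨ m∣n⇒n≡m*quotient p^ν[n]∣n ⟨
    n                             ∎)
    where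
    p^ν[n]∣n : p ^ ν p n ∣ n
    p^ν[n]∣n = p^ν∣n p n
    open ∣-Reasoning

  n/p^ν<n : ∀ {p n} → 1 < p → 0 < n → p ∣ n → quotient (p^ν∣n p n) < n
  n/p^ν<n {p} {n} 1<p 0<n p∣n = quotient-< (p^ν∣n p n) {{n>1⇒nonTrivial 1<p^ν}} {{>-nonZero 0<n}}
    where
    1<p^ν : 1 < p ^ ν p n
    1<p^ν = <-≤-trans 1<p (subst (_≤ p ^ ν p n) (^-identityʳ p)
              (^-monoʳ-≤ p {{>-nonZero (<-trans z<s 1<p)}} (p∣n⇒0<ν 1<p 0<n p∣n)))

  prime⇒1<p : ∀ {p} → Prime p → 1 < p
  prime⇒1<p {p} prime-p = nonTrivial⇒n>1 p {{prime⇒nonTrivial prime-p}}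

  coprime-* : ∀ {m n o} → Coprime m n → Coprime m o → Coprime m (n * o)
  coprime-* c₁ c₂ (i∣m , i∣n*o) =
    c₂ (i∣m , coprime-divisor (λ (j∣i , j∣n) → c₁ (∣-trans j∣i i∣m , j∣n)) i∣n*o)

  coprime-^ʳ : ∀ {m n} k → Coprime m n → Coprime m (n ^ k)
  coprime-^ʳ zero    _ = Coprime.sym (1-coprimeTo _)
  coprime-^ʳ (suc k) c = coprime-* c (coprime-^ʳ k c)

  coprime-^ˡ : ∀ {m n} k → Coprime m n → Coprime (m ^ k) n
  coprime-^ˡ k c = Coprime.sym (coprime-^ʳ k (Coprime.sym c))

  coprime-product : ∀ {m ns} → All (Coprime m) ns → Coprime m (product ns)
  coprime-product []       = Coprime.sym (1-coprimeTo _)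
  coprime-product (c ∷ cs) = coprime-* c (coprime-product cs)

  prime∤⇒coprime : ∀ {p n} → Prime p → ¬ (p ∣ n) → Coprime p n
  prime∤⇒coprime prime-p p∤n (i∣p , i∣n) with prime⇒irreducible prime-p i∣p
  ... | inj₁ i≡1 = i≡1
  ... | inj₂ refl = ⊥-elim (p∤n i∣n)

  distinct-primes-coprime : ∀ {p q} → Prime p → Prime q → p ≢ q → Coprime p q
  distinct-primes-coprime prime-p prime-q p≢q (i∣p , i∣q) with prime⇒irreducible prime-p i∣p
  ... | inj₁ i≡1 = i≡1
  ... | inj₂ refl with prime⇒irreducible prime-q i∣q
  ...   | inj₁ i≡1 = i≡1
  ...   | inj₂ p≡q = ⊥-elim (p≢q p≡q)

  coprime⇒*∣ : ∀ {m n o} → Coprime m n → m ∣ o → n ∣ o → m * n ∣ o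
  coprime⇒*∣ {m} {n} {o} c m∣o n∣o = subst (_∣ o) lcm≡m*n (lcm-least m∣o n∣o)
    where
    open ≡-Reasoning
    lcm≡m*n : lcm m n ≡ m * n
    lcm≡m*n = begin
      lcm m n            ≡⟨ *-identityˡ (lcm m n) ⟨
      1 * lcm m n        ≡⟨ cong (_* lcm m n) (coprime⇒gcd≡1 c) ⟨
      gcd m n * lcm m n  ≡⟨ gcd*lcm m n ⟩
      m * n              ∎

  prime-factor : ∀ n .{{_ : NonTrivial n}} → ∃[ p ] Prime p × p ∣ n
  prime-factor n@(2+ _) with factorise n
  ... | record { factors = [] ; isFactorisation = () }
  ... | record { factors = p ∷ ps ; isFactorisation = n≡p*Πps ; factorsPrime = prime-p ∷ _ } =
    p , prime-p , divides (product ps) (trans n≡p*Πps (*-comm p (product ps)))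

  ∣-from-prime-power-parts : ∀ {N} L → Acc _<_ L → 0 < L → (∀ p → Prime p → p ^ ν p L ∣ N) → L ∣ N
  ∣-from-prime-power-parts 1 _ _ _ = 1∣ _
  ∣-from-prime-power-parts {N} L@(2+ _) (acc rec) 0<L parts∣N with prime-factor L
  ... | p , prime-p , p∣L = subst (_∣ N) (sym L≡p^e*M) (coprime⇒*∣ p^e⊥M (parts∣N p prime-p) M∣N)
    where
    1<p : 1 < p
    1<p = prime⇒1<p prime-p
    M : ℕ
    M = quotient (p^ν∣n p L)
    L≡p^e*M : L ≡ p ^ ν p L * M
    L≡p^e*M = m∣n⇒n≡m*quotient (p^ν∣n p L)
    p^e⊥M : Coprime (p ^ ν p L) M
    p^e⊥M = coprime-^ˡ (ν p L) (prime∤⇒coprime prime-p (p∤n/p^ν 1<p 0<L))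
    0<M : 0 < M
    0<M = >-nonZero⁻¹ M {{quotient≢0 (p^ν∣n p L)}}
    M∣N : M ∣ N
    M∣N = ∣-from-prime-power-parts M (rec (n/p^ν<n 1<p 0<L p∣L)) 0<M λ q prime-q →
      ∣-trans (^-monoʳ-∣ q (ν-mono-∣ {m = M} (prime⇒1<p prime-q) 0<L (quotient-∣ (p^ν∣n p L))))
              (parts∣N q prime-q)

  x≤⌈x/d⌉*d : ∀ x d .{{_ : NonZero d}} → x ≤ ceilDiv x d * d
  x≤⌈x/d⌉*d x d@(suc y) = +-cancelʳ-≤ y x (q * d) (begin
    x + y                   ≡⟨ m≡m%n+[m/n]*n (x + y) d ⟩
    (x + y) % d + q * d     ≤⟨ +-monoˡ-≤ (q * d) (<⇒≤pred (m%n<n (x + y) d)) ⟩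
    y + q * d               ≡⟨ +-comm y (q * d) ⟩
    q * d + y               ∎)
    where
    q : ℕ
    q = (x + y) / d
    open ≤-Reasoning

  ∈⇒≤foldr-⊔ : ∀ {x xs} → x ∈ xs → x ≤ foldr _⊔_ 0 xs
  ∈⇒≤foldr-⊔ {xs = y ∷ ys} (here refl) = m≤m⊔n y (foldr _⊔_ 0 ys)
  ∈⇒≤foldr-⊔ {xs = y ∷ ys} (there x∈ys) = ≤-trans (∈⇒≤foldr-⊔ x∈ys) (m≤n⊔m y (foldr _⊔_ 0 ys))

  product-prime-power-parts-∣ : ∀ n {ps} → All Prime ps → Unique ps →
                                product (map (λ p → p ^ ν p n) ps) ∣ n
  product-prime-power-parts-∣ n []                 []                 = 1∣ n
  product-prime-power-parts-∣ n {p ∷ ps} (prime-p ∷ primes) (p∉ps ∷ unique) =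
    coprime⇒*∣ (coprime-product (All.map⁺ (All.zipWith coprime-parts (primes , p∉ps))))
               (p^ν∣n p n) (product-prime-power-parts-∣ n primes unique)
    where
    coprime-parts : ∀ {q} → Prime q × p ≢ q → Coprime (p ^ ν p n) (q ^ ν q n)
    coprime-parts {q} (prime-q , p≢q) =
      coprime-^ˡ (ν p n) (coprime-^ʳ (ν q n) (distinct-primes-coprime prime-p prime-q p≢q))

  ℓ-primes : ℕ → ℕ → List ℕ
  ℓ-primes L g = filter (λ p → prime? p ×-dec ¬? (p ∣? g)) (upTo (suc L))

  ℓ-primes-prime-∤ : ∀ L g → All (λ p → Prime p × ¬ (p ∣ g)) (ℓ-primes L g)
  ℓ-primes-prime-∤ L g = All.all-filter (λ p → prime? p ×-dec ¬? (p ∣? g)) (upTo (suc L))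

  ℓ∣L : ∀ L g → ℓ L g ∣ L
  ℓ∣L L g = product-prime-power-parts-∣ L (All.map proj₁ (ℓ-primes-prime-∤ L g))
              (Unique.filter⁺ (λ p → prime? p ×-dec ¬? (p ∣? g)) (Unique.upTo⁺ (suc L)))

  ℓ⊥g : ∀ L g → Coprime (ℓ L g) g
  ℓ⊥g L g = Coprime.sym (coprime-product (All.map⁺ (All.map g⊥p^ν (ℓ-primes-prime-∤ L g))))
    where
    g⊥p^ν : ∀ {p} → Prime p × ¬ (p ∣ g) → Coprime g (p ^ ν p L)
    g⊥p^ν {p} (prime-p , p∤g) = Coprime.sym (coprime-^ˡ (ν p L) (prime∤⇒coprime prime-p p∤g))

  p^ν∣ℓ : ∀ {p L} g → 0 < L → Prime p → ¬ (p ∣ g) → p ^ ν p L ∣ ℓ L g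
  p^ν∣ℓ {p} {L} g 0<L prime-p p∤g with ν p L in ν≡
  ... | zero  = 1∣ ℓ L g
  ... | suc _ = subst (λ e → p ^ e ∣ ℓ L g) ν≡ (∈⇒∣product (∈-map⁺ (λ q → q ^ ν q L) p∈ℓ-primes))
    where
    p≤L : p ≤ L
    p≤L = ∣⇒≤ {{>-nonZero 0<L}} (0<ν⇒p∣n (subst (0 <_) (sym ν≡) z<s))
    p∈ℓ-primes : p ∈ ℓ-primes L g
    p∈ℓ-primes = ∈-filter⁺ (λ p → prime? p ×-dec ¬? (p ∣? g)) (∈-upTo⁺ (s≤s p≤L)) (prime-p , p∤g)

  ⌈ν[L]/ν[g]⌉≤γ : ∀ {p} L {g} → 0 < g → Prime p → p ∣ g → ceilDiv (ν p L) (ν p g) ≤ γ L g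
  ⌈ν[L]/ν[g]⌉≤γ {p} L {g} 0<g prime-p p∣g = ∈⇒≤foldr-⊔ (∈-map⁺ (λ q → ceilDiv (ν q L) (ν q g))
    (∈-filter⁺ (λ q → prime? q ×-dec (q ∣? g)) (∈-upTo⁺ (s≤s (∣⇒≤ {{>-nonZero 0<g}} p∣g))) (prime-p , p∣g)))

  ν[L]≤ν[g]*κ : ∀ {p} L {g κ} → 0 < g → Prime p → p ∣ g → γ L g ≤ κ → ν p L ≤ ν p g * κ
  ν[L]≤ν[g]*κ {p} L {g} {κ} 0<g prime-p p∣g γ≤κ = begin
    ν p L                            ≤⟨ x≤⌈x/d⌉*d (ν p L) (ν p g) ⟩
    ceilDiv (ν p L) (ν p g) * ν p g  ≤⟨ *-monoˡ-≤ (ν p g) (≤-trans (⌈ν[L]/ν[g]⌉≤γ L 0<g prime-p p∣g) γ≤κ) ⟩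
    κ * ν p g                        ≡⟨ *-comm κ (ν p g) ⟩
    ν p g * κ                        ∎
    where
    open ≤-Reasoning
    instance
      _ : NonZero (ν p g)
      _ = >-nonZero (p∣n⇒0<ν (prime⇒1<p prime-p) 0<g p∣g)

  p^ν∣g^κ : ∀ {p} L {g κ} → 0 < g → Prime p → p ∣ g → γ L g ≤ κ → p ^ ν p L ∣ g ^ κ
  p^ν∣g^κ {p} L {g} {κ} 0<g prime-p p∣g γ≤κ = begin
    p ^ ν p L        ∣⟨ ^-monoʳ-∣ p (ν[L]≤ν[g]*κ L 0<g prime-p p∣g γ≤κ) ⟩
    p ^ (ν p g * κ)  ≡⟨ ^-*-assoc p (ν p g) κ ⟨
    (p ^ ν p g) ^ κ  ∣⟨ ^-monoˡ-∣ κ (p^ν∣n p g) ⟩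
    g ^ κ            ∎
    where open ∣-Reasoning

  L∣g^κ*ℓ : ∀ {L g κ} → 0 < L → 0 < g → γ L g ≤ κ → L ∣ g ^ κ * ℓ L g
  L∣g^κ*ℓ {L} {g} {κ} 0<L 0<g γ≤κ = ∣-from-prime-power-parts L (<-wellFounded L) 0<L part∣
    where
    part∣ : ∀ p → Prime p → p ^ ν p L ∣ g ^ κ * ℓ L g
    part∣ p prime-p with p ∣? g
    ... | yes p∣g = ∣m⇒∣m*n (ℓ L g) (p^ν∣g^κ L 0<g prime-p p∣g γ≤κ)
    ... | no  p∤g = ∣n⇒∣m*n (g ^ κ) (p^ν∣ℓ g 0<L prime-p p∤g)

open import Defs
open import Data.Nat using (ℕ; NonZero; _≤_)
open import Data.Nat.GCD using (gcd)
open import Data.Integer using (ℤ; +_; _+_; _*_; _^_; ∣_∣; 0ℤ)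
open import Data.Integer.Divisibility using (_∣_)
open import Data.Product using (∃-syntax; _×_)
open import Function.Bundles using (_⇔_)
open import Relation.Binary.PropositionalEquality using (_≡_; _≢_)

open NatArithmetic
import Data.Nat as ℕ
import Data.Nat.Properties as ℕ
import Data.Nat.Divisibility as ℕ
open import Data.Nat.Coprimality using (coprime-divisor)
open import Data.Nat.GCD using (gcd[m,n]≢0)
open import Data.Integer using (_-_)
open import Data.Integer.Properties using (abs-*; ∣i∣≡0⇒i≡0; *-identityʳ; *-distribˡ-+; ^-*-assoc)
import Data.Integer.Divisibility.Signed as Signed
open import Data.Integer.Solver using (module +-*-Solver)
open import Data.Product using (_,_)
open import Data.Sum using (inj₁)
open import Function.Bundles using (mk⇔)
open import Relation.Binary.PropositionalEquality using (refl; sym; trans; cong; cong₂; subst; module ≡-Reasoning)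

^-distrib-* : ∀ x y n → (x * y) ^ n ≡ x ^ n * y ^ n
^-distrib-* x y ℕ.zero    = refl
^-distrib-* x y (ℕ.suc n) = trans (cong (x * y *_) (^-distrib-* x y n)) (interchange x y (x ^ n) (y ^ n))
  where
  open +-*-Solver
  interchange : ∀ x y u v → x * y * (u * v) ≡ x * u * (y * v)
  interchange = solve 4 (λ x y u v → x :* y :* (u :* v) := x :* u :* (y :* v)) refl

∣i^n∣≡∣i∣^n : ∀ i n → ∣ i ^ n ∣ ≡ ∣ i ∣ ℕ.^ n
∣i^n∣≡∣i∣^n i ℕ.zero    = refl
∣i^n∣≡∣i∣^n i (ℕ.suc n) = trans (abs-* i (i ^ n)) (cong (∣ i ∣ ℕ.*_) (∣i^n∣≡∣i∣^n i n))

∣[ga]^n+[gb]^n∣≡g^n*∣a^n+b^n∣ : ∀ g {A B a b} n → A ≡ + g * a → B ≡ + g * b →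
                                ∣ A ^ n + B ^ n ∣ ≡ g ℕ.^ n ℕ.* ∣ a ^ n + b ^ n ∣
∣[ga]^n+[gb]^n∣≡g^n*∣a^n+b^n∣ g {a = a} {b} n refl refl = begin
  ∣ (+ g * a) ^ n + (+ g * b) ^ n ∣            ≡⟨ cong ∣_∣ (cong₂ _+_ (^-distrib-* (+ g) a n) (^-distrib-* (+ g) b n)) ⟩
  ∣ (+ g) ^ n * a ^ n + (+ g) ^ n * b ^ n ∣    ≡⟨ cong ∣_∣ (*-distribˡ-+ ((+ g) ^ n) (a ^ n) (b ^ n)) ⟨
  ∣ (+ g) ^ n * (a ^ n + b ^ n) ∣              ≡⟨ abs-* ((+ g) ^ n) (a ^ n + b ^ n) ⟩
  ∣ (+ g) ^ n ∣ ℕ.* ∣ a ^ n + b ^ n ∣          ≡⟨ cong (ℕ._* ∣ a ^ n + b ^ n ∣) (∣i^n∣≡∣i∣^n (+ g) n) ⟩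
  g ℕ.^ n ℕ.* ∣ a ^ n + b ^ n ∣                ∎
  where open ≡-Reasoning

x+y∣x^n+y^n⇒x+y∣x^[2+n]+y^[2+n] : ∀ x y n → (x + y) Signed.∣ x ^ n + y ^ n →
                                   (x + y) Signed.∣ x ^ ℕ.suc (ℕ.suc n) + y ^ ℕ.suc (ℕ.suc n)
x+y∣x^n+y^n⇒x+y∣x^[2+n]+y^[2+n] x y n x+y∣x^n+y^n =
  subst (x + y Signed.∣_) (sym (recurrence x y (x ^ n) (y ^ n)))
    (Signed.∣m∣n⇒∣m-n (Signed.∣m⇒∣m*n _ Signed.∣-refl) (Signed.∣n⇒∣m*n (x * y) x+y∣x^n+y^n))
  where
  open +-*-Solver
  recurrence : ∀ x y u v → x * (x * u) + y * (y * v) ≡ (x + y) * (x * u + y * v) - x * y * (u + v)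
  recurrence = solve 4 (λ x y u v →
    x :* (x :* u) :+ y :* (y :* v) := (x :+ y) :* (x :* u :+ y :* v) :- x :* y :* (u :+ v)) refl

x+y∣x^[1+2m]+y^[1+2m] : ∀ x y m → (x + y) Signed.∣ x ^ ℕ.suc (m ℕ.+ m) + y ^ ℕ.suc (m ℕ.+ m)
x+y∣x^[1+2m]+y^[1+2m] x y ℕ.zero    = subst (x + y Signed.∣_)
  (cong₂ _+_ (sym (*-identityʳ x)) (sym (*-identityʳ y))) Signed.∣-refl
x+y∣x^[1+2m]+y^[1+2m] x y (ℕ.suc m) = subst (λ e → (x + y) Signed.∣ x ^ ℕ.suc (ℕ.suc e) + y ^ ℕ.suc (ℕ.suc e))
  (sym (ℕ.+-suc m m)) (x+y∣x^n+y^n⇒x+y∣x^[2+n]+y^[2+n] x y (ℕ.suc (m ℕ.+ m)) (x+y∣x^[1+2m]+y^[1+2m] x y m))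

∣x^k+y^k⇒∣x^[k[1+2m]]+y^[k[1+2m]] : ∀ {n} x y k m → + n ∣ x ^ k + y ^ k →
                                    + n ∣ x ^ (k ℕ.* ℕ.suc (m ℕ.+ m)) + y ^ (k ℕ.* ℕ.suc (m ℕ.+ m))
∣x^k+y^k⇒∣x^[k[1+2m]]+y^[k[1+2m]] x y k m n∣x^k+y^k = ℕ.∣-trans n∣x^k+y^k
  (subst (λ z → x ^ k + y ^ k ∣ z) (cong₂ _+_ (^-*-assoc x k (ℕ.suc (m ℕ.+ m))) (^-*-assoc y k (ℕ.suc (m ℕ.+ m))))
    (Signed.∣⇒∣ᵤ (x+y∣x^[1+2m]+y^[1+2m] (x ^ k) (y ^ k) m)))

lemma3p3 : (A B : ℤ) → A ≢ 0ℤ → B ≢ 0ℤ → gcd ∣ A ∣ ∣ B ∣ ≢ 1 →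
    (a b : ℤ) → A ≡ + gcd ∣ A ∣ ∣ B ∣ * a → B ≡ + gcd ∣ A ∣ ∣ B ∣ * b →
    (L : ℕ) → NonZero L →
    ((∃[ K ] (NonZero K × (+ L ∣ A ^ K + B ^ K)))
      ⇔ (∃[ κ ] (NonZero κ × (γ L (gcd ∣ A ∣ ∣ B ∣) ≤ κ) × (+ ℓ L (gcd ∣ A ∣ ∣ B ∣) ∣ a ^ κ + b ^ κ))))
    × ((∃[ κ ] (NonZero κ × (γ L (gcd ∣ A ∣ ∣ B ∣) ≤ κ) × (+ ℓ L (gcd ∣ A ∣ ∣ B ∣) ∣ a ^ κ + b ^ κ)))
      ⇔ (∃[ k ] (NonZero k × (+ ℓ L (gcd ∣ A ∣ ∣ B ∣) ∣ a ^ k + b ^ k))))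
lemma3p3 A B A≢0 _ _ a b A≡ga B≡gb L@(ℕ.suc _) _ =
  mk⇔ (λ i → iii⇒ii (i⇒iii i)) ii⇒i , mk⇔ (λ (κ , κ≢0 , _ , ℓ∣) → κ , κ≢0 , ℓ∣) iii⇒ii
  where
  g : ℕ
  g = gcd ∣ A ∣ ∣ B ∣
  0<g : 0 ℕ.< g
  0<g = ℕ.n≢0⇒n>0 (gcd[m,n]≢0 ∣ A ∣ ∣ B ∣ (inj₁ (λ ∣A∣≡0 → A≢0 (∣i∣≡0⇒i≡0 ∣A∣≡0))))
  ∣A^n+B^n∣ : ∀ n → ∣ A ^ n + B ^ n ∣ ≡ g ℕ.^ n ℕ.* ∣ a ^ n + b ^ n ∣
  ∣A^n+B^n∣ n = ∣[ga]^n+[gb]^n∣≡g^n*∣a^n+b^n∣ g n A≡ga B≡gb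

  i⇒iii : ∃[ K ] (NonZero K × (+ L ∣ A ^ K + B ^ K)) → ∃[ k ] (NonZero k × (+ ℓ L g ∣ a ^ k + b ^ k))
  i⇒iii (K , K≢0 , L∣) = K , K≢0 ,
    coprime-divisor (coprime-^ʳ K (ℓ⊥g L g)) (ℕ.∣-trans (ℓ∣L L g) (subst (L ℕ.∣_) (∣A^n+B^n∣ K) L∣))

  iii⇒ii : ∃[ k ] (NonZero k × (+ ℓ L g ∣ a ^ k + b ^ k)) →
           ∃[ κ ] (NonZero κ × (γ L g ≤ κ) × (+ ℓ L g ∣ a ^ κ + b ^ κ))
  iii⇒ii (k@(ℕ.suc _) , _ , ℓ∣) = k ℕ.* ℕ.suc (γ L g ℕ.+ γ L g) , _ , γ≤κ ,
    ∣x^k+y^k⇒∣x^[k[1+2m]]+y^[k[1+2m]] a b k (γ L g) ℓ∣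
    where
    γ≤κ : γ L g ≤ k ℕ.* ℕ.suc (γ L g ℕ.+ γ L g)
    γ≤κ = ℕ.≤-trans (ℕ.≤-trans (ℕ.m≤m+n (γ L g) (γ L g)) (ℕ.n≤1+n _)) (ℕ.m≤n*m _ k)

  ii⇒i : ∃[ κ ] (NonZero κ × (γ L g ≤ κ) × (+ ℓ L g ∣ a ^ κ + b ^ κ)) → ∃[ K ] (NonZero K × (+ L ∣ A ^ K + B ^ K))
  ii⇒i (κ , κ≢0 , γ≤κ , ℓ∣) = κ , κ≢0 ,
    subst (L ℕ.∣_) (sym (∣A^n+B^n∣ κ)) (ℕ.∣-trans (L∣g^κ*ℓ ℕ.z<s 0<g γ≤κ) (ℕ.*-monoʳ-∣ (g ℕ.^ κ) ℓ∣))
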